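{- Let $k\ge r\ge 1$ be integers. Let $\mathcal{D}_{k,r}$ be the set of partitions $(\pi_1,\dots,\pi_\ell)$ such that (1) for every $1\le i\le \ell$ there is an integer $\varphi_{k,r}(\pi_i)\in\{1,\dots,r\}$ with $\pi_i\equiv \varphi_{k,r}(\pi_i)\pmod k$, and (2) for $1\le i<\ell$, $\varphi_{k,r}(\pi_i)\ge \varphi_{k,r}(\pi_{i+1})$ and $\pi_i-\pi_{i+1}\ge k$. Then \[\sum_{\pi\in\mathcal{D}_{k,r}} z^{\ell(\pi)}q^{|\pi|}=\sum_{m\ge 0}\frac{z^m q^{k\binom{m}{2}+m}}{(q^k;q^k)_m}{{m+r-1}\brack{r-1}}_1 .\]
   Context: A partition $\pi=(\pi_1,\dots,\pi_\ell)$ is a finite non-increasing sequence of positive integers; $\ell(\pi)$ is its number of parts and $|\pi|$ the sum of its parts (the empty partition is allowed). Throughout $|q|<1$. $(a;q)_\infty=\prod_{i\ge0}(1-aq^i)$ and $(a;q)_n=(a;q)_\infty/(aq^n;q)_\infty$. For nonnegative integers $A,B$ and a positive integer $k$, ${A\brack B}_k=\frac{(q^k;q^k)_A}{(q^k;q^k)_B(q^k;q^k)_{A-B}}$ if $A\ge B\ge 0$ and $0$ otherwise. -}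

module Defs where

open import Data.Nat using (ℕ; zero; suc; _+_; _*_; _∸_; _≤_; _≤ᵇ_; _≡ᵇ_; _%_)
open import Data.Nat.Combinatorics using (_C_)
open import Data.Integer as ℤ using (ℤ; +_)
open import Data.Bool using (if_then_else_)
open import Data.List using (List; []; _∷_)
open import Data.List.Relation.Unary.All using (All)
open import Data.List.Relation.Unary.Linked using (Linked)
open import Data.Product using (_×_; Σ; ∃)
open import Relation.Binary.PropositionalEquality using (_≡_)

IsPartition : List ℕ → Set
IsPartition π = All (λ p → 1 ≤ p) π × Linked (λ a b → b ≤ a) π

-- Φ k r p c  :  "c = φ_{k,r}(p)", i.e. c ∈ {1,…,r} and p ≡ c (mod k).
-- (For p ≥ 1, c ≤ r ≤ k, p ≡ c mod k forces p ≥ c, so the congruence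
--  is written p = c + j·k with j ∈ ℕ.)
Φ : ℕ → ℕ → ℕ → ℕ → Set
Φ k r p c = (1 ≤ c) × (c ≤ r) × ∃ λ (j : ℕ) → p ≡ c + j * k

ConsecD : ℕ → ℕ → ℕ → ℕ → Set
ConsecD k r a b =
  Σ ℕ λ ca → Σ ℕ λ cb → Φ k r a ca × Φ k r b cb × (cb ≤ ca) × (b + k ≤ a)

InD : ℕ → ℕ → List ℕ → Set
InD k r π = IsPartition π × All (λ p → ∃ λ c → Φ k r p c) π × Linked (ConsecD k r) π

-- Formal power series in q with integer coefficients: coefficient maps.

Series : Set
Series = ℕ → ℤ

sumTo : (ℕ → ℤ) → ℕ → ℤ
sumTo f zero = f zero
sumTo f (suc n) = sumTo f n ℤ.+ f (suc n)

_⊛_ : Series → Series → Series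
(f ⊛ g) n = sumTo (λ i → f i ℤ.* g (n ∸ i)) n
infixl 7 _⊛_

one : Series
one n = if n ≡ᵇ 0 then + 1 else + 0

zeroS : Series
zeroS n = + 0

qpow : ℕ → Series
qpow a n = if n ≡ᵇ a then + 1 else + 0

oneMinusQ : ℕ → Series
oneMinusQ d n = one n ℤ.- qpow d n

-- 1 / (1 - q^d) = Σ_j q^{d j}, for d ≥ 1 (the d = 0 case is never used)
geomInv : ℕ → Series
geomInv zero n = + 0
geomInv (suc e) n = if n % suc e ≡ᵇ 0 then + 1 else + 0

poch : ℕ → ℕ → Series
poch k zero = one
poch k (suc m) = poch k m ⊛ oneMinusQ (k * suc m)

-- 1 / (q^k;q^k)_m = Π_{i=1}^{m} 1/(1 - q^{k i})   (k ≥ 1)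
pochInv : ℕ → ℕ → Series
pochInv k zero = one
pochInv k (suc m) = pochInv k m ⊛ geomInv (k * suc m)

gauss : ℕ → ℕ → ℕ → Series
gauss k A B = if B ≤ᵇ A then poch k A ⊛ pochInv k B ⊛ pochInv k (A ∸ B) else zeroS

-- coefficient of z^m in the right-hand side:
--   q^{k·C(m,2)+m} / (q^k;q^k)_m · [m+r-1, r-1]_1
rhsCoeff : ℕ → ℕ → ℕ → Series
rhsCoeff k r m = qpow (k * (m C 2) + m) ⊛ pochInv k m ⊛ gauss 1 (m + r ∸ 1) (r ∸ 1)

{-# OPTIONS --safe #-}

-- Write each part of a partition in D_{k,r} as p = c + j·k with residue c ∈ [1, r] and quotient j.
-- Listed in increasing order, condition (2) says exactly that the residues increase weakly and the
-- quotients strictly, because 0 ≤ c′ − c < k. Hence D_{k,r}-partitions with m parts correspond,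
-- preserving weight, to pairs (j, c) of such sequences of length m, and the generating function
-- factorises: strictly increasing j ≥ 0 weighted by k·Σj contribute q^(k·C(m,2)) / (q^k; q^k)_m, and
-- weakly increasing c in [1, r] contribute q^m [m+r−1, r−1]. Each factor is realised by explicit
-- duplicate-free lists of the objects of each weight, whose lengths multiply under the Cauchy product.

module Submission where

open import Defs

open import Algebra.Bundles using (CommutativeMonoid)
open import Algebra.Structures using (IsCommutativeMonoid)
open import Data.Bool using (true; false; if_then_else_)
open import Data.Bool.Properties using (T-≡)
open import Data.Integer as ℤ using (ℤ; +_)
import Data.Integer.Properties as ℤ
import Data.Integer.Tactic.RingSolver as ℤ-Solver
open import Data.List
  using (List; []; _∷_; _++_; map; length; cartesianProduct; zipWith; reverse; reverseAcc)
import Data.List.Properties as List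
open import Data.List.Membership.Propositional using (_∈_)
open import Data.List.Membership.Propositional.Properties
  using (∈-map⁺; ∈-map⁻; ∈-++⁺ˡ; ∈-++⁺ʳ; ∈-++⁻; ∈-cartesianProduct⁺; ∈-cartesianProduct⁻)
open import Data.List.Relation.Binary.Permutation.Propositional using (↭-sym)
open import Data.List.Relation.Binary.Permutation.Propositional.Properties using (↭-reverse; All-resp-↭)
open import Data.List.Relation.Unary.All as All using (All; []; _∷_)
import Data.List.Relation.Unary.All.Properties as All
import Data.List.Relation.Unary.AllPairs as AllPairs
open import Data.List.Relation.Unary.Any using (here)
open import Data.List.Relation.Unary.Linked as Linked using (Linked; []; [-]; _∷_)
open import Data.List.Relation.Unary.Linked.Properties
  using (Linked⇒All; Linked⇒AllPairs) renaming (map⁺ to Linked-map⁺; map⁻ to Linked-map⁻)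
open import Data.List.Relation.Unary.Unique.Propositional using (Unique; []; _∷_)
import Data.List.Relation.Unary.Unique.Propositional.Properties as Unique
open import Data.Nat
  using (ℕ; zero; suc; pred; NonZero; _+_; _*_; _∸_; _⊓_; _≤_; _<_; _≡ᵇ_; _%_; z≤n; s≤s)
open import Data.Nat.Combinatorics using (_C_; nC1≡n; nCk+nC[k+1]≡[n+1]C[k+1])
open import Data.Nat.Divisibility using (n∣m*n)
open import Data.Nat.DivMod
  using ( _/_; /-monoˡ-≤; m/n≡1+[m∸n]/n; +-distrib-/-∣ʳ; m<n⇒m/n≡0; m*n/n≡m
        ; [m+kn]%n≡m%n; m<n⇒m%n≡m; m≤n⇒[n∸m]%m≡n%m; m*n%n≡0; m≡m%n+[m/n]*n )
open import Data.Nat.ListAction using (sum)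
open import Data.Nat.ListAction.Properties using (sum-↭)
open import Data.Nat.Properties
  using ( ≤-refl; ≤-trans; <-trans; <-irrefl; ≤-pred; ≤-<-connex; m≤n⇒m<n∨m≡n; m≤n⇒m≤1+n
        ; m≤m+n; m≤n+m; ≤⇒≤ᵇ; suc-injective; pred-mono-≤; ⊓-idem
        ; +-identityʳ; +-suc; +-cancelˡ-≡; +-cancelˡ-<; +-mono-≤; +-monoʳ-<
        ; *-identityˡ; *-identityʳ; *-zeroʳ; *-distribˡ-+; *-monoˡ-≤
        ; n∸n≡0; +-∸-assoc; ∸-+-assoc; ∸-monoˡ-≤
        ; m+[n∸m]≡n; m∸[m∸n]≡n; m+n∸m≡n; m+n∸n≡m )
import Data.Nat.Tactic.RingSolver as ℕ-Solver
open import Data.Product using (_×_; _,_; proj₁; proj₂; Σ; ∃; map₂; assocʳ′)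
open import Data.Sum using (_⊎_; inj₁; inj₂; [_,_]′)
open import Data.Sum.Properties using (inj₁-injective; inj₂-injective)
open import Data.Unit using (⊤; tt)
open import Function using (_∘_; flip)
open import Function.Bundles using (Equivalence; _⇔_; mk⇔)
open import Level using (0ℓ)
open import Relation.Binary.Bundles using (Setoid)
import Relation.Binary.Reasoning.Setoid
open import Relation.Binary.PropositionalEquality
open import Relation.Nullary using (¬_)
open import Relation.Unary using (_⟨×⟩_; _⟨⊎⟩_)

sumTo-cong : ∀ {f g} n → (∀ i → i ≤ n → f i ≡ g i) → sumTo f n ≡ sumTo g n
sumTo-cong zero    f≗g = f≗g 0 z≤n
sumTo-cong (suc n) f≗g =
  cong₂ ℤ._+_ (sumTo-cong n (λ i i≤n → f≗g i (m≤n⇒m≤1+n i≤n))) (f≗g (suc n) ≤-refl)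

sumTo-zero : ∀ n → sumTo (λ _ → + 0) n ≡ + 0
sumTo-zero zero    = refl
sumTo-zero (suc n) = cong (ℤ._+ + 0) (sumTo-zero n)

sumTo-+ : ∀ f g n → sumTo (λ i → f i ℤ.+ g i) n ≡ sumTo f n ℤ.+ sumTo g n
sumTo-+ f g zero    = refl
sumTo-+ f g (suc n) = trans (cong (ℤ._+ (f (suc n) ℤ.+ g (suc n))) (sumTo-+ f g n))
  (interchange (sumTo f n) (sumTo g n) (f (suc n)) (g (suc n)))
  where
  interchange : ∀ a b c d → (a ℤ.+ b) ℤ.+ (c ℤ.+ d) ≡ (a ℤ.+ c) ℤ.+ (b ℤ.+ d)
  interchange = ℤ-Solver.solve-∀

sumTo-- : ∀ f g n → sumTo (λ i → f i ℤ.- g i) n ≡ sumTo f n ℤ.- sumTo g n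
sumTo-- f g zero    = refl
sumTo-- f g (suc n) = trans (cong (ℤ._+ (f (suc n) ℤ.- g (suc n))) (sumTo-- f g n))
  (interchange (sumTo f n) (sumTo g n) (f (suc n)) (g (suc n)))
  where
  interchange : ∀ a b c d → (a ℤ.- b) ℤ.+ (c ℤ.- d) ≡ (a ℤ.+ c) ℤ.- (b ℤ.+ d)
  interchange = ℤ-Solver.solve-∀

sumTo-*ˡ : ∀ c f n → sumTo (λ i → c ℤ.* f i) n ≡ c ℤ.* sumTo f n
sumTo-*ˡ c f zero    = refl
sumTo-*ˡ c f (suc n) = trans (cong (ℤ._+ c ℤ.* f (suc n)) (sumTo-*ˡ c f n))
  (sym (ℤ.*-distribˡ-+ c (sumTo f n) (f (suc n))))

sumTo-*ʳ : ∀ c f n → sumTo (λ i → f i ℤ.* c) n ≡ sumTo f n ℤ.* c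
sumTo-*ʳ c f zero    = refl
sumTo-*ʳ c f (suc n) = trans (cong (ℤ._+ f (suc n) ℤ.* c) (sumTo-*ʳ c f n))
  (sym (ℤ.*-distribʳ-+ c (sumTo f n) (f (suc n))))

sumTo-suc : ∀ f n → sumTo f (suc n) ≡ f 0 ℤ.+ sumTo (f ∘ suc) n
sumTo-suc f zero    = refl
sumTo-suc f (suc n) = trans (cong (ℤ._+ f (suc (suc n))) (sumTo-suc f n))
  (ℤ.+-assoc (f 0) (sumTo (f ∘ suc) n) (f (suc (suc n))))

sumTo-reverse : ∀ f n → sumTo f n ≡ sumTo (λ i → f (n ∸ i)) n
sumTo-reverse f zero    = refl
sumTo-reverse f (suc n) = begin
  sumTo f n ℤ.+ f (suc n)                ≡⟨ cong (ℤ._+ f (suc n)) (sumTo-reverse f n) ⟩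
  sumTo f′ n ℤ.+ f (suc n)               ≡⟨ ℤ.+-comm (sumTo f′ n) (f (suc n)) ⟩
  f (suc n) ℤ.+ sumTo f′ n               ≡⟨ sym (sumTo-suc (λ i → f (suc n ∸ i)) n) ⟩
  sumTo (λ i → f (suc n ∸ i)) (suc n)    ∎
  where
  open ≡-Reasoning
  f′ = λ i → f (n ∸ i)

sumTo-triangle : ∀ (X : ℕ → ℕ → ℤ) n →
  sumTo (λ i → sumTo (X i) i) n ≡ sumTo (λ j → sumTo (λ l → X (j + l) j) (n ∸ j)) n
sumTo-triangle X zero    = refl
sumTo-triangle X (suc n) = begin
  sumTo (λ i → sumTo (X i) i) n ℤ.+ (sumTo (X (suc n)) n ℤ.+ X (suc n) (suc n))
    ≡⟨ cong (ℤ._+ (sumTo (X (suc n)) n ℤ.+ X (suc n) (suc n))) (sumTo-triangle X n) ⟩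
  Columns n ℤ.+ (sumTo (X (suc n)) n ℤ.+ X (suc n) (suc n))
    ≡⟨ sym (ℤ.+-assoc (Columns n) (sumTo (X (suc n)) n) (X (suc n) (suc n))) ⟩
  (Columns n ℤ.+ sumTo (X (suc n)) n) ℤ.+ X (suc n) (suc n)
    ≡⟨ cong₂ ℤ._+_ (sym (sumTo-+ _ (X (suc n)) n)) corner ⟩
  sumTo (λ j → Column j (n ∸ j) ℤ.+ X (suc n) j) n ℤ.+ Column (suc n) 0
    ≡⟨ cong₂ ℤ._+_ (sumTo-cong n extendColumn) (cong (Column (suc n)) (sym (n∸n≡0 n))) ⟩
  Columns (suc n) ∎
  where
  open ≡-Reasoning
  Column : ℕ → ℕ → ℤ
  Column j = sumTo (λ l → X (j + l) j)
  Columns : ℕ → ℤ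
  Columns m = sumTo (λ j → Column j (m ∸ j)) m
  corner : X (suc n) (suc n) ≡ X (suc n + 0) (suc n)
  corner = cong (λ i → X i (suc n)) (sym (+-identityʳ (suc n)))
  extendColumn : ∀ j → j ≤ n → Column j (n ∸ j) ℤ.+ X (suc n) j ≡ Column j (suc n ∸ j)
  extendColumn j j≤n rewrite +-∸-assoc 1 j≤n =
    cong (λ i → Column j (n ∸ j) ℤ.+ X i j)
      (sym (trans (+-suc j (n ∸ j)) (cong suc (m+[n∸m]≡n j≤n))))

-- Power series

≗-setoid : Setoid 0ℓ 0ℓ
≗-setoid = record
  { Carrier       = Series
  ; _≈_           = _≗_
  ; isEquivalence = record
    { refl  = λ _ → refl
    ; sym   = λ f≗g n → sym (f≗g n)
    ; trans = λ f≗g g≗h n → trans (f≗g n) (g≗h n)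
    }
  }

open Setoid ≗-setoid using () renaming (sym to ≗-sym; trans to ≗-trans)

module ≗-Reasoning = Relation.Binary.Reasoning.Setoid ≗-setoid

infixl 6 _⊕_ _⊖_

_⊕_ : Series → Series → Series
(f ⊕ g) n = f n ℤ.+ g n

_⊖_ : Series → Series → Series
(f ⊖ g) n = f n ℤ.- g n

⊕-cong : ∀ {f f′ g g′} → f ≗ f′ → g ≗ g′ → f ⊕ g ≗ f′ ⊕ g′
⊕-cong f≗f′ g≗g′ n = cong₂ ℤ._+_ (f≗f′ n) (g≗g′ n)

⊕-congʳ : ∀ f {g g′} → g ≗ g′ → f ⊕ g ≗ f ⊕ g′
⊕-congʳ f g≗g′ n = cong (λ x → f n ℤ.+ x) (g≗g′ n)

⊛-cong : ∀ {f f′ g g′} → f ≗ f′ → g ≗ g′ → f ⊛ g ≗ f′ ⊛ g′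
⊛-cong f≗f′ g≗g′ n = sumTo-cong n (λ i _ → cong₂ ℤ._*_ (f≗f′ i) (g≗g′ (n ∸ i)))

⊛-congˡ : ∀ {f f′} g → f ≗ f′ → f ⊛ g ≗ f′ ⊛ g
⊛-congˡ {f} {f′} g f≗f′ = ⊛-cong {f} {f′} {g} {g} f≗f′ (λ _ → refl)

⊛-congʳ : ∀ f {g g′} → g ≗ g′ → f ⊛ g ≗ f ⊛ g′
⊛-congʳ f {g} {g′} = ⊛-cong {f} {f} {g} {g′} (λ _ → refl)

⊛-comm : ∀ f g → f ⊛ g ≗ g ⊛ f
⊛-comm f g n = trans (sumTo-reverse _ n) (sumTo-cong n λ i i≤n →
  trans (cong (λ j → f (n ∸ i) ℤ.* g j) (m∸[m∸n]≡n i≤n)) (ℤ.*-comm (f (n ∸ i)) (g i)))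

⊛-assoc : ∀ f g h → (f ⊛ g) ⊛ h ≗ f ⊛ (g ⊛ h)
⊛-assoc f g h n = begin
  sumTo (λ i → sumTo (λ j → f j ℤ.* g (i ∸ j)) i ℤ.* h (n ∸ i)) n
    ≡⟨ sumTo-cong n (λ i _ → sym (sumTo-*ʳ (h (n ∸ i)) _ i)) ⟩
  sumTo (λ i → sumTo (λ j → f j ℤ.* g (i ∸ j) ℤ.* h (n ∸ i)) i) n
    ≡⟨ sumTo-triangle (λ i j → f j ℤ.* g (i ∸ j) ℤ.* h (n ∸ i)) n ⟩
  sumTo (λ j → sumTo (λ l → f j ℤ.* g (j + l ∸ j) ℤ.* h (n ∸ (j + l))) (n ∸ j)) n
    ≡⟨ sumTo-cong n (λ j _ →
         trans (sumTo-cong (n ∸ j) (λ l _ → reindex j l)) (sumTo-*ˡ (f j) _ (n ∸ j))) ⟩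
  sumTo (λ j → f j ℤ.* sumTo (λ l → g l ℤ.* h (n ∸ j ∸ l)) (n ∸ j)) n ∎
  where
  open ≡-Reasoning
  reindex : ∀ j l →
    f j ℤ.* g (j + l ∸ j) ℤ.* h (n ∸ (j + l)) ≡ f j ℤ.* (g l ℤ.* h (n ∸ j ∸ l))
  reindex j l = trans (cong₂ (λ a b → f j ℤ.* g a ℤ.* h b) (m+n∸m≡n j l) (sym (∸-+-assoc n j l)))
                      (ℤ.*-assoc (f j) (g l) (h (n ∸ j ∸ l)))

⊛-distribʳ-⊕ : ∀ f g h → (f ⊕ g) ⊛ h ≗ f ⊛ h ⊕ g ⊛ h
⊛-distribʳ-⊕ f g h n =
  trans (sumTo-cong n (λ i _ → ℤ.*-distribʳ-+ (h (n ∸ i)) (f i) (g i))) (sumTo-+ _ _ n)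

⊛-distribʳ-⊖ : ∀ f g h → (f ⊖ g) ⊛ h ≗ f ⊛ h ⊖ g ⊛ h
⊛-distribʳ-⊖ f g h n =
  trans (sumTo-cong n (λ i _ → distrib (f i) (g i) (h (n ∸ i)))) (sumTo-- _ _ n)
  where
  distrib : ∀ a b c → (a ℤ.- b) ℤ.* c ≡ a ℤ.* c ℤ.- b ℤ.* c
  distrib = ℤ-Solver.solve-∀

⊛-distribˡ-⊕ : ∀ f g h → f ⊛ (g ⊕ h) ≗ f ⊛ g ⊕ f ⊛ h
⊛-distribˡ-⊕ f g h n = begin
  (f ⊛ (g ⊕ h)) n        ≡⟨ ⊛-comm f (g ⊕ h) n ⟩
  ((g ⊕ h) ⊛ f) n        ≡⟨ ⊛-distribʳ-⊕ g h f n ⟩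
  (g ⊛ f ⊕ h ⊛ f) n      ≡⟨ cong₂ ℤ._+_ (⊛-comm g f n) (⊛-comm h f n) ⟩
  (f ⊛ g ⊕ f ⊛ h) n      ∎
  where open ≡-Reasoning

⊛-distribˡ-⊖ : ∀ f g h → f ⊛ (g ⊖ h) ≗ f ⊛ g ⊖ f ⊛ h
⊛-distribˡ-⊖ f g h n = begin
  (f ⊛ (g ⊖ h)) n        ≡⟨ ⊛-comm f (g ⊖ h) n ⟩
  ((g ⊖ h) ⊛ f) n        ≡⟨ ⊛-distribʳ-⊖ g h f n ⟩
  (g ⊛ f ⊖ h ⊛ f) n      ≡⟨ cong₂ ℤ._-_ (⊛-comm g f n) (⊛-comm h f n) ⟩
  (f ⊛ g ⊖ f ⊛ h) n      ∎
  where open ≡-Reasoning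

shift : ℕ → Series → Series
shift zero    f n       = f n
shift (suc a) f zero    = + 0
shift (suc a) f (suc n) = shift a f n

shift-< : ∀ {a n} f → n < a → shift a f n ≡ + 0
shift-< {suc a} {zero}  f _         = refl
shift-< {suc a} {suc n} f (s≤s n<a) = shift-< f n<a

shift-≥ : ∀ {a n} f → a ≤ n → shift a f n ≡ f (n ∸ a)
shift-≥ {zero}          f _         = refl
shift-≥ {suc a} {suc n} f (s≤s a≤n) = shift-≥ f a≤n

qpow-⊛ : ∀ a f → qpow a ⊛ f ≗ shift a f
qpow-⊛ zero    f zero    = ℤ.*-identityˡ (f 0)
qpow-⊛ zero    f (suc n) = begin
  (qpow 0 ⊛ f) (suc n)
    ≡⟨ sumTo-suc (λ i → qpow 0 i ℤ.* f (suc n ∸ i)) n ⟩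
  + 1 ℤ.* f (suc n) ℤ.+ sumTo (λ _ → + 0) n
    ≡⟨ cong₂ ℤ._+_ (ℤ.*-identityˡ (f (suc n))) (sumTo-zero n) ⟩
  f (suc n) ℤ.+ + 0
    ≡⟨ ℤ.+-identityʳ (f (suc n)) ⟩
  f (suc n) ∎
  where open ≡-Reasoning
qpow-⊛ (suc a) f zero    = refl
qpow-⊛ (suc a) f (suc n) = begin
  (qpow (suc a) ⊛ f) (suc n)            ≡⟨ sumTo-suc (λ i → qpow (suc a) i ℤ.* f (suc n ∸ i)) n ⟩
  + 0 ℤ.+ (qpow a ⊛ f) n                ≡⟨ ℤ.+-identityˡ ((qpow a ⊛ f) n) ⟩
  (qpow a ⊛ f) n                        ≡⟨ qpow-⊛ a f n ⟩
  shift a f n                           ∎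
  where open ≡-Reasoning

⊛-identityˡ : ∀ f → one ⊛ f ≗ f
⊛-identityˡ = qpow-⊛ 0

⊛-identityʳ : ∀ f → f ⊛ one ≗ f
⊛-identityʳ f = ≗-trans (⊛-comm f one) (⊛-identityˡ f)

⊛-isCommutativeMonoid : IsCommutativeMonoid _≗_ _⊛_ one
⊛-isCommutativeMonoid = record
  { isMonoid = record
    { isSemigroup = record
      { isMagma = record { isEquivalence = Setoid.isEquivalence ≗-setoid ; ∙-cong = ⊛-cong }
      ; assoc   = ⊛-assoc
      }
    ; identity = ⊛-identityˡ , ⊛-identityʳ
    }
  ; comm = ⊛-comm
  }

⊛-commutativeMonoid : CommutativeMonoid 0ℓ 0ℓ
⊛-commutativeMonoid = record { isCommutativeMonoid = ⊛-isCommutativeMonoid }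

open import Algebra.Properties.CommutativeSemigroup
  (CommutativeMonoid.commutativeSemigroup ⊛-commutativeMonoid)
  using (interchange; x∙yz≈y∙xz; x∙yz≈y∙zx; xy∙z≈xz∙y)

shift-qpow : ∀ a b → shift a (qpow b) ≗ qpow (a + b)
shift-qpow zero    b n       = refl
shift-qpow (suc a) b zero    = refl
shift-qpow (suc a) b (suc n) = shift-qpow a b n

qpow-+ : ∀ a b → qpow a ⊛ qpow b ≗ qpow (a + b)
qpow-+ a b = ≗-trans (qpow-⊛ a (qpow b)) (shift-qpow a b)

oneMinusQ-⊛ : ∀ d f → oneMinusQ d ⊛ f ≗ f ⊖ shift d f
oneMinusQ-⊛ d f n =
  trans (⊛-distribʳ-⊖ one (qpow d) f n) (cong₂ ℤ._-_ (⊛-identityˡ f n) (qpow-⊛ d f n))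

oneMinusQ-+ : ∀ a b → oneMinusQ a ⊕ qpow a ⊛ oneMinusQ b ≗ oneMinusQ (a + b)
oneMinusQ-+ a b n = begin
  oneMinusQ a n ℤ.+ (qpow a ⊛ oneMinusQ b) n
    ≡⟨ cong (λ x → oneMinusQ a n ℤ.+ x) (⊛-distribˡ-⊖ (qpow a) one (qpow b) n) ⟩
  oneMinusQ a n ℤ.+ ((qpow a ⊛ one) n ℤ.- (qpow a ⊛ qpow b) n)
    ≡⟨ cong₂ (λ x y → oneMinusQ a n ℤ.+ (x ℤ.- y)) (⊛-identityʳ (qpow a) n) (qpow-+ a b n) ⟩
  (one n ℤ.- qpow a n) ℤ.+ (qpow a n ℤ.- qpow (a + b) n)
    ≡⟨ telescope (one n) (qpow a n) (qpow (a + b) n) ⟩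
  oneMinusQ (a + b) n ∎
  where
  open ≡-Reasoning
  telescope : ∀ x y z → (x ℤ.- y) ℤ.+ (y ℤ.- z) ≡ x ℤ.- z
  telescope = ℤ-Solver.solve-∀

geomInv-inverse : ∀ e → oneMinusQ (suc e) ⊛ geomInv (suc e) ≗ one
geomInv-inverse e n = trans (oneMinusQ-⊛ (suc e) G n) (telescope n)
  where
  G = geomInv (suc e)
  telescope : ∀ n → G n ℤ.- shift (suc e) G n ≡ one n
  telescope n with ≤-<-connex (suc e) n
  ... | inj₁ d≤n@(s≤s _) rewrite shift-≥ G d≤n | m≤n⇒[n∸m]%m≡n%m d≤n = ℤ.+-inverseʳ (G n)
  ... | inj₂ n<d rewrite shift-< G n<d | m<n⇒m%n≡m n<d = ℤ.+-identityʳ (one n)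

poch-inverse : ∀ k m → poch (suc k) m ⊛ pochInv (suc k) m ≗ one
poch-inverse k zero    = ⊛-identityˡ one
poch-inverse k (suc m) = begin
  (poch (suc k) m ⊛ O) ⊛ (pochInv (suc k) m ⊛ G)
    ≈⟨ interchange (poch (suc k) m) O (pochInv (suc k) m) G ⟩
  (poch (suc k) m ⊛ pochInv (suc k) m) ⊛ (O ⊛ G)
    ≈⟨ ⊛-cong (poch-inverse k m) (geomInv-inverse (m + k * suc m)) ⟩
  one ⊛ one
    ≈⟨ ⊛-identityˡ one ⟩
  one ∎
  where
  open ≗-Reasoning
  O = oneMinusQ (suc k * suc m)
  G = geomInv (suc k * suc m)

-- Enumerations by weight

Enumeration : Set → Set
Enumeration X = ℕ → List X

count : ∀ {X : Set} → Enumeration X → Series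
count F n = + length (F n)

record IsEnumeration {X : Set} (F : Enumeration X) (P : X → Set) (w : X → ℕ) : Set where
  field
    sound    : ∀ {n x} → x ∈ F n → P x × w x ≡ n
    complete : ∀ {x} → P x → x ∈ F (w x)
    unique   : ∀ n → Unique (F n)

  complete′ : ∀ {n x} → P x → w x ≡ n → x ∈ F n
  complete′ px refl = complete px

open IsEnumeration public

point : ∀ {X : Set} → X → Enumeration X
point x zero    = x ∷ []
point x (suc n) = []

count-point : ∀ {X : Set} (x : X) → count (point x) ≗ one
count-point x zero    = refl
count-point x (suc n) = refl

point-isEnumeration : ∀ {X : Set} {x : X} {P w} → P x → w x ≡ 0 → (∀ {y} → P y → y ≡ x) →
                      IsEnumeration (point x) P w
point-isEnumeration px wx≡0 onlyX .sound {zero} (here refl) = px , wx≡0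
point-isEnumeration px wx≡0 onlyX .complete py with refl ← onlyX py rewrite wx≡0 = here refl
point-isEnumeration px wx≡0 onlyX .unique zero    = [] ∷ []
point-isEnumeration px wx≡0 onlyX .unique (suc n) = []

raise : ∀ {X : Set} → ℕ → Enumeration X → Enumeration X
raise zero    F n       = F n
raise (suc a) F zero    = []
raise (suc a) F (suc n) = raise a F n

count-raise : ∀ {X : Set} a (F : Enumeration X) → count (raise a F) ≗ qpow a ⊛ count F
count-raise a F = ≗-trans (shifted a) (≗-sym (qpow-⊛ a (count F)))
  where
  shifted : ∀ a → count (raise a F) ≗ shift a (count F)
  shifted zero    n       = refl
  shifted (suc a) zero    = refl
  shifted (suc a) (suc n) = shifted a n

raise-isEnumeration : ∀ {X : Set} a {F : Enumeration X} {P w} → IsEnumeration F P w →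
                      IsEnumeration (raise a F) P (λ x → a + w x)
raise-isEnumeration zero    E .sound               = sound E
raise-isEnumeration (suc a) E .sound {suc n} x∈    = map₂ (cong suc) (sound (raise-isEnumeration a E) x∈)
raise-isEnumeration zero    E .complete            = complete E
raise-isEnumeration (suc a) E .complete            = complete (raise-isEnumeration a E)
raise-isEnumeration zero    E .unique              = unique E
raise-isEnumeration (suc a) E .unique zero         = []
raise-isEnumeration (suc a) E .unique (suc n)      = unique (raise-isEnumeration a E) n

concatUpTo : ∀ {X : Set} → (ℕ → List X) → ℕ → List X
concatUpTo h zero    = h zero
concatUpTo h (suc n) = concatUpTo h n ++ h (suc n)

length-concatUpTo : ∀ {X : Set} (h : ℕ → List X) n →
                    + length (concatUpTo h n) ≡ sumTo (λ i → + length (h i)) n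
length-concatUpTo h zero    = refl
length-concatUpTo h (suc n) =
  trans (cong +_ (List.length-++ (concatUpTo h n)))
        (cong (ℤ._+ + length (h (suc n))) (length-concatUpTo h n))

∈-concatUpTo⁻ : ∀ {X : Set} (h : ℕ → List X) n {z} →
                z ∈ concatUpTo h n → ∃ λ i → i ≤ n × z ∈ h i
∈-concatUpTo⁻ h zero    z∈ = 0 , z≤n , z∈
∈-concatUpTo⁻ h (suc n) z∈ with ∈-++⁻ (concatUpTo h n) z∈
... | inj₁ z∈ˡ = let i , i≤n , z∈hᵢ = ∈-concatUpTo⁻ h n z∈ˡ
                in i , m≤n⇒m≤1+n i≤n , z∈hᵢ
... | inj₂ z∈ʳ = suc n , ≤-refl , z∈ʳ

∈-concatUpTo⁺ : ∀ {X : Set} (h : ℕ → List X) {n i z} →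
                i ≤ n → z ∈ h i → z ∈ concatUpTo h n
∈-concatUpTo⁺ h {zero}  z≤n z∈ = z∈
∈-concatUpTo⁺ h {suc n} i≤n z∈ with m≤n⇒m<n∨m≡n i≤n
... | inj₁ i<n    = ∈-++⁺ˡ (∈-concatUpTo⁺ h (≤-pred i<n) z∈)
... | inj₂ refl   = ∈-++⁺ʳ (concatUpTo h n) z∈

concatUpTo-unique : ∀ {X : Set} (h : ℕ → List X) (index : X → ℕ) → (∀ i → Unique (h i)) →
                    (∀ {i z} → z ∈ h i → index z ≡ i) → ∀ n → Unique (concatUpTo h n)
concatUpTo-unique h index unique-h indexed zero    = unique-h zero
concatUpTo-unique h index unique-h indexed (suc n) =
  Unique.++⁺ (concatUpTo-unique h index unique-h indexed n) (unique-h (suc n)) disjoint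
  where
  disjoint : ∀ {z} → ¬ (z ∈ concatUpTo h n × z ∈ h (suc n))
  disjoint (z∈ˡ , z∈ʳ) with ∈-concatUpTo⁻ h n z∈ˡ
  ... | i , i≤n , z∈hi = <-irrefl (trans (sym (indexed z∈hi)) (indexed z∈ʳ)) (s≤s i≤n)

length-cartesianProduct : ∀ {X Y : Set} (xs : List X) (ys : List Y) →
                          length (cartesianProduct xs ys) ≡ length xs * length ys
length-cartesianProduct []       ys = refl
length-cartesianProduct (x ∷ xs) ys =
  trans (List.length-++ (map (x ,_) ys))
        (cong₂ _+_ (List.length-map (x ,_) ys) (length-cartesianProduct xs ys))

infixr 7 _⋆_

_⋆_ : ∀ {X Y : Set} → Enumeration X → Enumeration Y → Enumeration (X × Y)
(F ⋆ G) n = concatUpTo (λ i → cartesianProduct (F i) (G (n ∸ i))) n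

count-⋆ : ∀ {X Y : Set} (F : Enumeration X) (G : Enumeration Y) →
          count (F ⋆ G) ≗ count F ⊛ count G
count-⋆ F G n = trans (length-concatUpTo _ n) (sumTo-cong n (λ i _ →
  trans (cong +_ (length-cartesianProduct (F i) (G (n ∸ i))))
        (ℤ.pos-* (length (F i)) (length (G (n ∸ i))))))

⋆-isEnumeration : ∀ {X Y : Set} {F : Enumeration X} {G : Enumeration Y} {P Q v w} →
                  IsEnumeration F P v → IsEnumeration G Q w →
                  IsEnumeration (F ⋆ G) (P ⟨×⟩ Q) (λ (x , y) → v x + w y)
⋆-isEnumeration {F = F} {G} E₁ E₂ .sound {n} z∈
  with i , i≤n , z∈ᵢ ← ∈-concatUpTo⁻ _ n z∈
  with x∈ , y∈ ← ∈-cartesianProduct⁻ (F i) (G (n ∸ i)) z∈ᵢ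
  with (px , refl) ← sound E₁ x∈ | (qy , wy) ← sound E₂ y∈
  = (px , qy) , trans (cong₂ _+_ refl wy) (m+[n∸m]≡n i≤n)
⋆-isEnumeration {v = v} {w} E₁ E₂ .complete {x , y} (px , qy) =
  ∈-concatUpTo⁺ _ (m≤m+n (v x) (w y))
    (∈-cartesianProduct⁺ (complete E₁ px) (complete′ E₂ qy (sym (m+n∸m≡n (v x) (w y)))))
⋆-isEnumeration {F = F} {G} {v = v} E₁ E₂ .unique n =
  concatUpTo-unique _ (v ∘ proj₁)
    (λ i → Unique.cartesianProduct⁺ (unique E₁ i) (unique E₂ (n ∸ i)))
    (λ {i} z∈ → proj₂ (sound E₁ (proj₁ (∈-cartesianProduct⁻ (F i) (G (n ∸ i)) z∈)))) n

infixr 6 _⊎ᴱ_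

_⊎ᴱ_ : ∀ {X Y : Set} → Enumeration X → Enumeration Y → Enumeration (X ⊎ Y)
(F ⊎ᴱ G) n = map inj₁ (F n) ++ map inj₂ (G n)

count-⊎ᴱ : ∀ {X Y : Set} (F : Enumeration X) (G : Enumeration Y) →
           count (F ⊎ᴱ G) ≗ count F ⊕ count G
count-⊎ᴱ F G n = begin
  + length (map inj₁ (F n) ++ map inj₂ (G n))
    ≡⟨ cong +_ (List.length-++ (map inj₁ (F n))) ⟩
  + (length (map inj₁ (F n)) + length (map inj₂ (G n)))
    ≡⟨ cong₂ (λ a b → + (a + b)) (List.length-map inj₁ (F n)) (List.length-map inj₂ (G n)) ⟩
  + (length (F n) + length (G n))
    ≡⟨ ℤ.pos-+ (length (F n)) (length (G n)) ⟩
  (count F ⊕ count G) n ∎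
  where open ≡-Reasoning

⊎ᴱ-isEnumeration : ∀ {X Y : Set} {F : Enumeration X} {G : Enumeration Y} {P Q v w} →
                   IsEnumeration F P v → IsEnumeration G Q w →
                   IsEnumeration (F ⊎ᴱ G) (P ⟨⊎⟩ Q) [ v , w ]′
⊎ᴱ-isEnumeration {F = F} E₁ E₂ .sound {n} z∈ with ∈-++⁻ (map inj₁ (F n)) z∈
... | inj₁ z∈₁ with x , x∈ , refl ← ∈-map⁻ inj₁ z∈₁ = sound E₁ x∈
... | inj₂ z∈₂ with y , y∈ , refl ← ∈-map⁻ inj₂ z∈₂ = sound E₂ y∈
⊎ᴱ-isEnumeration E₁ E₂ .complete {inj₁ x} px = ∈-++⁺ˡ (∈-map⁺ inj₁ (complete E₁ px))
⊎ᴱ-isEnumeration {F = F} E₁ E₂ .complete {inj₂ y} qy =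
  ∈-++⁺ʳ (map inj₁ (F _)) (∈-map⁺ inj₂ (complete E₂ qy))
⊎ᴱ-isEnumeration E₁ E₂ .unique n =
  Unique.++⁺ (Unique.map⁺ inj₁-injective (unique E₁ n)) (Unique.map⁺ inj₂-injective (unique E₂ n))
    disjoint
  where
  disjoint : ∀ {z} → ¬ (z ∈ map inj₁ _ × z ∈ map inj₂ _)
  disjoint (z∈₁ , z∈₂) with _ , _ , refl ← ∈-map⁻ inj₁ z∈₁
                       with _ , _ , () ← ∈-map⁻ inj₂ z∈₂

Unique-map⁺ : ∀ {X Y : Set} {P : X → Set} (f : X → Y) →
              (∀ {x x′} → P x → P x′ → f x ≡ f x′ → x ≡ x′) →
              ∀ {xs} → All P xs → Unique xs → Unique (map f xs)
Unique-map⁺ f injective []         []        = []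
Unique-map⁺ f injective (px ∷ pxs) (x∉ ∷ u) =
  All.map⁺ (All.zipWith (λ (x≢y , py) fx≡fy → x≢y (injective px py fx≡fy)) (x∉ , pxs))
  ∷ Unique-map⁺ f injective pxs u

count-map : ∀ {X Y : Set} (f : X → Y) (F : Enumeration X) → count (map f ∘ F) ≗ count F
count-map f F n = cong +_ (List.length-map f (F n))

map-isEnumeration : ∀ {X Y : Set} {F : Enumeration X} {P : X → Set} {Q : Y → Set} {v w}
                    (f : X → Y) →
                    IsEnumeration F P v →
                    (∀ {x} → P x → Q (f x) × w (f x) ≡ v x) →
                    (∀ {y} → Q y → ∃ λ x → P x × f x ≡ y) →
                    (∀ {x x′} → P x → P x′ → f x ≡ f x′ → x ≡ x′) →
                    IsEnumeration (map f ∘ F) Q w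
map-isEnumeration f E forward backward injective .sound y∈ with x , x∈ , refl ← ∈-map⁻ f y∈ =
  let px , vx≡n = sound E x∈ in map₂ (λ wfx≡vx → trans wfx≡vx vx≡n) (forward px)
map-isEnumeration f E forward backward injective .complete qy with x , px , refl ← backward qy =
  ∈-map⁺ f (complete′ E px (sym (proj₂ (forward px))))
map-isEnumeration f E forward backward injective .unique n =
  Unique-map⁺ f injective (All.tabulate (proj₁ ∘ sound E)) (unique E n)

-- Weakly increasing sequences in a box

length≡0⇒≡[] : ∀ {X : Set} {xs : List X} → length xs ≡ 0 → xs ≡ []
length≡0⇒≡[] {xs = []} _ = refl

WeaklyIncreasing : List ℕ → Set
WeaklyIncreasing = Linked _≤_

Box : ℕ → ℕ → List ℕ → Set
Box m s u = WeaklyIncreasing u × All (_≤ s) u × length u ≡ m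

sum-map-+ : ∀ c xs → sum (map (λ x → c + x) xs) ≡ length xs * c + sum xs
sum-map-+ c []       = refl
sum-map-+ c (x ∷ xs) =
  trans (cong (λ t → c + x + t) (sum-map-+ c xs)) (rearrange c x (length xs * c) (sum xs))
  where
  rearrange : ∀ a b d e → a + b + (d + e) ≡ a + d + (b + e)
  rearrange = ℕ-Solver.solve-∀

sum-map-suc : ∀ {m} v → length v ≡ m → sum (map suc v) ≡ m + sum v
sum-map-suc v refl = trans (sum-map-+ 1 v) (cong (_+ sum v) (*-identityʳ (length v)))

Box-cons0 : ∀ {m s v} → Box m s v → Box (suc m) s (0 ∷ v)
Box-cons0 {v = []}    (_   , []  , refl) = [-] , z≤n ∷ [] , refl
Box-cons0 {v = _ ∷ _} (inc , bnd , refl) = z≤n ∷ inc , z≤n ∷ bnd , refl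

Box-tail : ∀ {m s x v} → Box (suc m) s (x ∷ v) → Box m s v
Box-tail (inc , _ ∷ bnd , len) = Linked.tail inc , bnd , suc-injective len

Box-map-suc : ∀ {m s v} → Box m s v → Box m (suc s) (map suc v)
Box-map-suc {v = v} (inc , bnd , len) =
  Linked-map⁺ (Linked.map s≤s inc) , All.map⁺ (All.map s≤s bnd) , trans (List.length-map suc v) len

Box-map-pred : ∀ {m s u} → Box m (suc s) u → Box m s (map pred u)
Box-map-pred {u = u} (inc , bnd , len) =
  Linked-map⁺ (Linked.map pred-mono-≤ inc) , All.map⁺ (All.map pred-mono-≤ bnd) ,
  trans (List.length-map pred u) len

map-suc-pred : ∀ {u} → All (1 ≤_) u → map suc (map pred u) ≡ u
map-suc-pred []               = refl
map-suc-pred (s≤s z≤n ∷ pos) = cong (_ ∷_) (map-suc-pred pos)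

recombine : List ℕ ⊎ List ℕ → List ℕ
recombine = [ 0 ∷_ , map suc ]′

-- A sequence in the box either starts with 0, or has only positive entries; lowering these by one
-- lowers the weight by the length. This is the q-Pascal recursion of the Gaussian binomial.
boxes : ℕ → ℕ → Enumeration (List ℕ)
boxes zero    s       = point []
boxes (suc m) zero    = map (0 ∷_) ∘ boxes m zero
boxes (suc m) (suc s) = map recombine ∘ (boxes m (suc s) ⊎ᴱ raise (suc m) (boxes (suc m) s))

boxes-isEnumeration : ∀ m s → IsEnumeration (boxes m s) (Box m s) sum
boxes-isEnumeration zero s =
  point-isEnumeration ([] , [] , refl) refl (length≡0⇒≡[] ∘ proj₂ ∘ proj₂)
boxes-isEnumeration (suc m) zero =
  map-isEnumeration (0 ∷_) (boxes-isEnumeration m zero) (λ box → Box-cons0 box , refl) unconsZero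
    (λ _ _ → List.∷-injectiveʳ)
  where
  unconsZero : ∀ {u} → Box (suc m) zero u → ∃ λ v → Box m zero v × 0 ∷ v ≡ u
  unconsZero {zero ∷ v}  box              = v , Box-tail box , refl
  unconsZero {suc _ ∷ _} (_ , () ∷ _ , _)
boxes-isEnumeration (suc m) (suc s) =
  map-isEnumeration recombine
    (⊎ᴱ-isEnumeration (boxes-isEnumeration m (suc s))
                      (raise-isEnumeration (suc m) (boxes-isEnumeration (suc m) s)))
    (λ {z} → forward {z}) (λ {u} → backward {u}) (λ {z z′} → injective {z} {z′})
  where
  Split = Box m (suc s) ⟨⊎⟩ Box (suc m) s
  forward : ∀ {z} → Split z →
            Box (suc m) (suc s) (recombine z) × sum (recombine z) ≡ [ sum , (λ v → suc m + sum v) ]′ z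
  forward {inj₁ v} box = Box-cons0 box , refl
  forward {inj₂ v} box = Box-map-suc box , sum-map-suc v (proj₂ (proj₂ box))
  backward : ∀ {u} → Box (suc m) (suc s) u → ∃ λ z → Split z × recombine z ≡ u
  backward {zero ∷ v}  box = inj₁ v , Box-tail box , refl
  backward {suc x ∷ v} box = inj₂ (map pred (suc x ∷ v)) , Box-map-pred box ,
    map-suc-pred (Linked⇒All ≤-trans (s≤s z≤n) (proj₁ box))
  injective : ∀ {z z′} → Split z → Split z′ → recombine z ≡ recombine z′ → z ≡ z′
  injective {inj₁ _}       {inj₁ _}       _ _ eq = cong inj₁ (List.∷-injectiveʳ eq)
  injective {inj₂ _}       {inj₂ _}       _ _ eq = cong inj₂ (List.map-injective suc-injective eq)
  injective {inj₁ _}       {inj₂ []}      _ _ ()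
  injective {inj₁ _}       {inj₂ (_ ∷ _)} _ _ ()
  injective {inj₂ []}      {inj₁ _}       _ _ ()
  injective {inj₂ (_ ∷ _)} {inj₁ _}       _ _ ()

count-boxes-zero : ∀ m → count (boxes m zero) ≗ one
count-boxes-zero zero    = count-point []
count-boxes-zero (suc m) = ≗-trans (count-map (0 ∷_) (boxes m zero)) (count-boxes-zero m)

count-boxes-suc : ∀ m s →
  count (boxes (suc m) (suc s)) ≗ count (boxes m (suc s)) ⊕ qpow (suc m) ⊛ count (boxes (suc m) s)
count-boxes-suc m s =
  ≗-trans (count-map recombine (boxes m (suc s) ⊎ᴱ raise (suc m) (boxes (suc m) s)))
  (≗-trans (count-⊎ᴱ (boxes m (suc s)) (raise (suc m) (boxes (suc m) s)))
           (⊕-congʳ (count (boxes m (suc s))) (count-raise (suc m) (boxes (suc m) s))))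

poch-suc : ∀ n → poch 1 (suc n) ≗ poch 1 n ⊛ oneMinusQ (suc n)
poch-suc n i = cong (λ d → (poch 1 n ⊛ oneMinusQ d) i) (*-identityˡ (suc n))

poch-boxes : ∀ m s → poch 1 (m + s) ≗ count (boxes m s) ⊛ (poch 1 s ⊛ poch 1 m)
poch-boxes zero s = ≗-sym (begin
  count (point []) ⊛ (poch 1 s ⊛ one)    ≈⟨ ⊛-cong (count-point []) (⊛-identityʳ (poch 1 s)) ⟩
  one ⊛ poch 1 s                         ≈⟨ ⊛-identityˡ (poch 1 s) ⟩
  poch 1 s                               ∎)
  where open ≗-Reasoning
poch-boxes (suc m) zero = ≗-sym (begin
  count (boxes (suc m) zero) ⊛ (one ⊛ poch 1 (suc m))
    ≈⟨ ⊛-cong (count-boxes-zero (suc m)) (⊛-identityˡ (poch 1 (suc m))) ⟩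
  one ⊛ poch 1 (suc m)
    ≈⟨ ⊛-identityˡ (poch 1 (suc m)) ⟩
  poch 1 (suc m)
    ≈⟨ (λ i → cong (λ n → poch 1 n i) (sym (+-identityʳ (suc m)))) ⟩
  poch 1 (suc m + zero) ∎)
  where open ≗-Reasoning
-- With N = m + s + 1, use 1 − q^(N+1) = (1 − q^(m+1)) + q^(m+1) (1 − q^(s+1)).
poch-boxes (suc m) (suc s) = ≗-sym (begin
  count (boxes (suc m) (suc s)) ⊛ (P (suc s) ⊛ P (suc m))
    ≈⟨ ⊛-congˡ (P (suc s) ⊛ P (suc m)) (count-boxes-suc m s) ⟩
  (B₁ ⊕ q ⊛ B₂) ⊛ (P (suc s) ⊛ P (suc m))
    ≈⟨ ⊛-distribʳ-⊕ B₁ (q ⊛ B₂) (P (suc s) ⊛ P (suc m)) ⟩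
  B₁ ⊛ (P (suc s) ⊛ P (suc m)) ⊕ (q ⊛ B₂) ⊛ (P (suc s) ⊛ P (suc m))
    ≈⟨ ⊕-cong lowered raised ⟩
  P N ⊛ O₁ ⊕ q ⊛ (P N ⊛ O₂)
    ≈⟨ ⊕-congʳ (P N ⊛ O₁) (x∙yz≈y∙xz q (P N) O₂) ⟩
  P N ⊛ O₁ ⊕ P N ⊛ (q ⊛ O₂)
    ≈⟨ ≗-sym (⊛-distribˡ-⊕ (P N) O₁ (q ⊛ O₂)) ⟩
  P N ⊛ (O₁ ⊕ q ⊛ O₂)
    ≈⟨ ⊛-congʳ (P N) (oneMinusQ-+ (suc m) (suc s)) ⟩
  P N ⊛ oneMinusQ (suc N)
    ≈⟨ ≗-sym (poch-suc N) ⟩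
  P (suc N) ∎)
  where
  open ≗-Reasoning
  P = poch 1
  N = m + suc s
  q = qpow (suc m)
  O₁ = oneMinusQ (suc m)
  O₂ = oneMinusQ (suc s)
  B₁ = count (boxes m (suc s))
  B₂ = count (boxes (suc m) s)
  lowered : B₁ ⊛ (P (suc s) ⊛ P (suc m)) ≗ P N ⊛ O₁
  lowered = begin
    B₁ ⊛ (P (suc s) ⊛ P (suc m))      ≈⟨ ⊛-congʳ B₁ (⊛-congʳ (P (suc s)) (poch-suc m)) ⟩
    B₁ ⊛ (P (suc s) ⊛ (P m ⊛ O₁))     ≈⟨ ⊛-congʳ B₁ (≗-sym (⊛-assoc (P (suc s)) (P m) O₁)) ⟩
    B₁ ⊛ ((P (suc s) ⊛ P m) ⊛ O₁)     ≈⟨ ≗-sym (⊛-assoc B₁ (P (suc s) ⊛ P m) O₁) ⟩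
    (B₁ ⊛ (P (suc s) ⊛ P m)) ⊛ O₁     ≈⟨ ⊛-congˡ O₁ (≗-sym (poch-boxes m (suc s))) ⟩
    P N ⊛ O₁                          ∎
  raised : (q ⊛ B₂) ⊛ (P (suc s) ⊛ P (suc m)) ≗ q ⊛ (P N ⊛ O₂)
  raised = begin
    (q ⊛ B₂) ⊛ (P (suc s) ⊛ P (suc m))
      ≈⟨ ⊛-assoc q B₂ (P (suc s) ⊛ P (suc m)) ⟩
    q ⊛ (B₂ ⊛ (P (suc s) ⊛ P (suc m)))
      ≈⟨ ⊛-congʳ q (⊛-congʳ B₂ (⊛-congˡ (P (suc m)) (poch-suc s))) ⟩
    q ⊛ (B₂ ⊛ ((P s ⊛ O₂) ⊛ P (suc m)))
      ≈⟨ ⊛-congʳ q (⊛-congʳ B₂ (xy∙z≈xz∙y (P s) O₂ (P (suc m)))) ⟩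
    q ⊛ (B₂ ⊛ ((P s ⊛ P (suc m)) ⊛ O₂))
      ≈⟨ ⊛-congʳ q (≗-sym (⊛-assoc B₂ (P s ⊛ P (suc m)) O₂)) ⟩
    q ⊛ ((B₂ ⊛ (P s ⊛ P (suc m))) ⊛ O₂)
      ≈⟨ ⊛-congʳ q (⊛-congˡ O₂ (≗-sym (poch-boxes (suc m) s))) ⟩
    q ⊛ (P (suc m + s) ⊛ O₂)
      ≈⟨ ⊛-congʳ q (⊛-congˡ O₂ (λ i → cong (λ n → P n i) (sym (+-suc m s)))) ⟩
    q ⊛ (P N ⊛ O₂) ∎

count-boxes : ∀ m s → count (boxes m s) ≗ gauss 1 (m + s) s
count-boxes m s rewrite Equivalence.to T-≡ (≤⇒≤ᵇ (m≤n+m s m)) | m+n∸n≡m m s = ≗-sym (begin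
  (P (m + s) ⊛ I s) ⊛ I m          ≈⟨ ⊛-congˡ (I m) (⊛-congˡ (I s) (poch-boxes m s)) ⟩
  ((B ⊛ (P s ⊛ P m)) ⊛ I s) ⊛ I m  ≈⟨ ⊛-assoc (B ⊛ (P s ⊛ P m)) (I s) (I m) ⟩
  (B ⊛ (P s ⊛ P m)) ⊛ (I s ⊛ I m)  ≈⟨ ⊛-assoc B (P s ⊛ P m) (I s ⊛ I m) ⟩
  B ⊛ ((P s ⊛ P m) ⊛ (I s ⊛ I m))  ≈⟨ ⊛-congʳ B (interchange (P s) (P m) (I s) (I m)) ⟩
  B ⊛ ((P s ⊛ I s) ⊛ (P m ⊛ I m))  ≈⟨ ⊛-congʳ B (⊛-cong (poch-inverse 0 s) (poch-inverse 0 m)) ⟩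
  B ⊛ (one ⊛ one)                  ≈⟨ ⊛-congʳ B (⊛-identityˡ one) ⟩
  B ⊛ one                          ≈⟨ ⊛-identityʳ B ⟩
  B                                ∎)
  where
  open ≗-Reasoning
  P = poch 1
  I = pochInv 1
  B = count (boxes m s)

Linked-reverse⁺ : ∀ {A : Set} {R : A → A → Set} {xs} → Linked (flip R) xs → Linked R (reverse xs)
Linked-reverse⁺ {R = R} {[]}     _      = []
Linked-reverse⁺ {R = R} {x ∷ xs} linked = go xs [-] linked
  where
  go : ∀ {x acc} xs →
       Linked R (x ∷ acc) → Linked (flip R) (x ∷ xs) → Linked R (reverseAcc (x ∷ acc) xs)
  go []       acc-linked _            = acc-linked
  go (y ∷ xs) acc-linked (Ryx ∷ rest) = go xs (Ryx ∷ acc-linked) rest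

All-reverse⁺ : ∀ {A : Set} {P : A → Set} {xs} → All P xs → All P (reverse xs)
All-reverse⁺ {xs = xs} = All-resp-↭ (↭-sym (↭-reverse xs))

sum-reverse : ∀ xs → sum (reverse xs) ≡ sum xs
sum-reverse xs = sum-↭ (↭-reverse xs)

-- Strictly increasing sequences

StrictlyIncreasing : List ℕ → Set
StrictlyIncreasing = Linked _<_

StrictSeq : ℕ → List ℕ → Set
StrictSeq m j = StrictlyIncreasing j × length j ≡ m

multiples : ∀ d .{{_ : NonZero d}} → Enumeration ℕ
multiples d n = if n % d ≡ᵇ 0 then n / d ∷ [] else []

count-multiples : ∀ e → count (multiples (suc e)) ≗ geomInv (suc e)
count-multiples e n with n % suc e ≡ᵇ 0
... | true  = refl
... | false = refl

multiples-isEnumeration : ∀ d .{{_ : NonZero d}} → IsEnumeration (multiples d) (λ _ → ⊤) (_* d)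
multiples-isEnumeration d .sound {n} t∈ with n % d | m≡m%n+[m/n]*n n d
multiples-isEnumeration d .sound (here refl) | zero | n≡[n/d]*d = tt , sym n≡[n/d]*d
multiples-isEnumeration d {{d≢0}} .complete {t} _ rewrite m*n%n≡0 t d {{d≢0}} =
  here (sym (m*n/n≡m t d))
multiples-isEnumeration d .unique n with n % d ≡ᵇ 0
... | true  = [] ∷ []
... | false = []

prepend : ℕ × List ℕ → List ℕ
prepend (t , j) = t ∷ map (λ x → suc t + x) j

prepend-injective : ∀ {a b} → prepend a ≡ prepend b → a ≡ b
prepend-injective {t , _} eq with refl , eqʳ ← List.∷-injective eq =
  cong (t ,_) (List.map-injective (+-cancelˡ-≡ (suc t) _ _) eqʳ)

prepend-increasing : ∀ t {j} → StrictlyIncreasing j → StrictlyIncreasing (prepend (t , j))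
prepend-increasing t {[]}    _   = [-]
prepend-increasing t {x ∷ _} inc =
  s≤s (m≤m+n t x) ∷ Linked-map⁺ (Linked.map (+-monoʳ-< (suc t)) inc)

unprepend : ∀ {t j} → All (t <_) j → ∃ λ j′ → map (λ x → suc t + x) j′ ≡ j
unprepend []          = [] , refl
unprepend (t<x ∷ t<j) = let j′ , eq = unprepend t<j in _ ∷ j′ , cong₂ _∷_ (m+[n∸m]≡n t<x) eq

sum-prepend : ∀ k t j →
  k * sum (prepend (t , j)) ≡ t * (k * suc (length j)) + (k * length j + k * sum j)
sum-prepend k t j =
  trans (cong (λ x → k * (t + x)) (sum-map-+ (suc t) j)) (expand k t (length j) (sum j))
  where
  expand : ∀ k t l s → k * (t + (l * suc t + s)) ≡ t * (k * suc l) + (k * l + k * s)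
  expand = ℕ-Solver.solve-∀

m+mC2≡[1+m]C2 : ∀ m → m + m C 2 ≡ suc m C 2
m+mC2≡[1+m]C2 m = trans (cong (_+ m C 2) (sym (nC1≡n m))) (nCk+nC[k+1]≡[n+1]C[k+1] m 1)

module _ (k′ : ℕ) where

  private
    k : ℕ
    k = suc k′

  -- A sequence of length m + 1 is its least entry t followed by t + 1 + (a sequence of length m),
  -- so its weight is t·k(m+1) + k·m + (the weight of the shorter sequence).
  strictSeqs : ℕ → Enumeration (List ℕ)
  strictSeqs zero    = point []
  strictSeqs (suc m) = map prepend ∘ (multiples (k * suc m) ⋆ raise (k * m) (strictSeqs m))

  strictSeqs-isEnumeration : ∀ m → IsEnumeration (strictSeqs m) (StrictSeq m) (λ j → k * sum j)
  strictSeqs-isEnumeration zero =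
    point-isEnumeration ([] , refl) (*-zeroʳ k) (length≡0⇒≡[] ∘ proj₂)
  strictSeqs-isEnumeration (suc m) =
    map-isEnumeration prepend
      (⋆-isEnumeration (multiples-isEnumeration (k * suc m))
                       (raise-isEnumeration (k * m) (strictSeqs-isEnumeration m)))
      forward backward (λ _ _ → prepend-injective)
    where
    Split = (λ _ → ⊤) ⟨×⟩ StrictSeq m
    forward : ∀ {z} → Split z →
              StrictSeq (suc m) (prepend z) ×
              k * sum (prepend z) ≡ proj₁ z * (k * suc m) + (k * m + k * sum (proj₂ z))
    forward {t , j} (_ , inc , refl) =
      (prepend-increasing t inc , cong suc (List.length-map _ j)) , sum-prepend k t j
    backward : ∀ {j} → StrictSeq (suc m) j → ∃ λ z → Split z × prepend z ≡ j
    backward {t ∷ j} (inc , len)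
      with j′ , refl ← unprepend (AllPairs.head (Linked⇒AllPairs <-trans inc)) =
      (t , j′) , (tt , Linked.map (+-cancelˡ-< (suc t) _ _) (Linked-map⁻ (Linked.tail inc)) ,
                  trans (sym (List.length-map _ j′)) (suc-injective len)) , refl

  count-strictSeqs : ∀ m → count (strictSeqs m) ≗ qpow (k * (m C 2)) ⊛ pochInv k m
  count-strictSeqs zero = begin
    count (point [])          ≈⟨ count-point [] ⟩
    one                       ≈⟨ ≗-sym (⊛-identityʳ one) ⟩
    one ⊛ one                 ≈⟨ ⊛-congˡ one (λ n → cong (λ a → qpow a n) (sym (*-zeroʳ k))) ⟩
    qpow (k * 0) ⊛ one        ∎
    where open ≗-Reasoning
  count-strictSeqs (suc m) = begin
    count (strictSeqs (suc m))
      ≈⟨ count-map prepend (multiples (k * suc m) ⋆ raise (k * m) (strictSeqs m)) ⟩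
    count (multiples (k * suc m) ⋆ raise (k * m) (strictSeqs m))
      ≈⟨ count-⋆ (multiples (k * suc m)) (raise (k * m) (strictSeqs m)) ⟩
    count (multiples (k * suc m)) ⊛ count (raise (k * m) (strictSeqs m))
      ≈⟨ ⊛-cong (count-multiples (m + k′ * suc m)) (count-raise (k * m) (strictSeqs m)) ⟩
    G ⊛ (qpow (k * m) ⊛ count (strictSeqs m))
      ≈⟨ ⊛-congʳ G (⊛-congʳ (qpow (k * m)) (count-strictSeqs m)) ⟩
    G ⊛ (qpow (k * m) ⊛ (qpow (k * (m C 2)) ⊛ pochInv k m))
      ≈⟨ ⊛-congʳ G (≗-sym (⊛-assoc (qpow (k * m)) (qpow (k * (m C 2))) (pochInv k m))) ⟩
    G ⊛ ((qpow (k * m) ⊛ qpow (k * (m C 2))) ⊛ pochInv k m)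
      ≈⟨ ⊛-congʳ G (⊛-congˡ (pochInv k m) (qpow-+ (k * m) (k * (m C 2)))) ⟩
    G ⊛ (qpow (k * m + k * (m C 2)) ⊛ pochInv k m)
      ≈⟨ x∙yz≈y∙zx G (qpow (k * m + k * (m C 2))) (pochInv k m) ⟩
    qpow (k * m + k * (m C 2)) ⊛ (pochInv k m ⊛ G)
      ≈⟨ ⊛-congˡ (pochInv k m ⊛ G) (λ n → cong (λ a → qpow a n) exponent) ⟩
    qpow (k * (suc m C 2)) ⊛ pochInv k (suc m) ∎
    where
    open ≗-Reasoning
    G = geomInv (k * suc m)
    exponent : k * m + k * (m C 2) ≡ k * (suc m C 2)
    exponent = trans (sym (*-distribˡ-+ k m (m C 2))) (cong (k *_) (m+mC2≡[1+m]C2 m))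

  -- A part p ≥ 1 is written p = c + j·k with 1 ≤ c ≤ k: dividing p − 1 by k gives j and c − 1.
  part : ℕ → ℕ → ℕ
  part j c = c + j * k

  quotient : ℕ → ℕ
  quotient p = (p ∸ 1) / k

  residue : ℕ → ℕ
  residue p = suc ((p ∸ 1) % k)

  quotient-part : ∀ j {c} → 1 ≤ c → c ≤ k → quotient (part j c) ≡ j
  quotient-part j {suc c} _ c<k = begin
    (c + j * k) / k      ≡⟨ +-distrib-/-∣ʳ c (n∣m*n j) ⟩
    c / k + j * k / k    ≡⟨ cong₂ _+_ (m<n⇒m/n≡0 c<k) (m*n/n≡m j k) ⟩
    j                    ∎
    where open ≡-Reasoning

  residue-part : ∀ j {c} → 1 ≤ c → c ≤ k → residue (part j c) ≡ c
  residue-part j {suc c} _ c<k = cong suc (trans ([m+kn]%n≡m%n c j k) (m<n⇒m%n≡m c<k))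

  part-quotient-residue : ∀ {p} → 1 ≤ p → part (quotient p) (residue p) ≡ p
  part-quotient-residue {suc p} _ = cong suc (sym (m≡m%n+[m/n]*n p k))

  quotient-mono-≤ : ∀ {p p′} → p ≤ p′ → quotient p ≤ quotient p′
  quotient-mono-≤ p≤p′ = /-monoˡ-≤ k (∸-monoˡ-≤ 1 p≤p′)

  quotient-+k : ∀ {p} → 1 ≤ p → quotient (p + k) ≡ suc (quotient p)
  quotient-+k {suc p} _ =
    trans (m/n≡1+[m∸n]/n (m≤n+m k p)) (cong (λ x → suc (x / k)) (m+n∸n≡m p k))

  -- Partitions in D_{k,r}

  module _ (s : ℕ) (r≤k : suc s ≤ k) where

    private
      r : ℕ
      r = suc s

    InRange : ℕ → Set
    InRange c = 1 ≤ c × c ≤ r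

    HasResidue : ℕ → Set
    HasResidue p = ∃ λ c → Φ k r p c

    residue-Φ : ∀ {p c} → Φ k r p c → residue p ≡ c
    residue-Φ (1≤c , c≤r , j , refl) = residue-part j 1≤c (≤-trans c≤r r≤k)

    Φ-positive : ∀ {p c} → Φ k r p c → 1 ≤ p
    Φ-positive {c = c} (1≤c , _ , j , refl) = ≤-trans 1≤c (m≤m+n c (j * k))

    ConsecD-part : ∀ {j₀ j₁ c₀ c₁} →
                   InRange c₀ → InRange c₁ → c₀ ≤ c₁ → j₀ < j₁ → ConsecD k r (part j₁ c₁) (part j₀ c₀)
    ConsecD-part {j₀} {j₁} {c₀} {c₁} (1≤c₀ , c₀≤r) (1≤c₁ , c₁≤r) c₀≤c₁ j₀<j₁ =
      c₁ , c₀ , (1≤c₁ , c₁≤r , j₁ , refl) , (1≤c₀ , c₀≤r , j₀ , refl) , c₀≤c₁ ,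
      subst (_≤ part j₁ c₁) (regroup c₀ j₀ k) (+-mono-≤ c₀≤c₁ (*-monoˡ-≤ k j₀<j₁))
      where
      regroup : ∀ c j k → c + suc j * k ≡ c + j * k + k
      regroup = ℕ-Solver.solve-∀

    ConsecD-residue-quotient : ∀ {a b} → ConsecD k r a b →
                               residue b ≤ residue a × quotient b < quotient a
    ConsecD-residue-quotient {a} (_ , _ , Φa , Φb , c_b≤cₐ , b+k≤a) =
      subst₂ _≤_ (sym (residue-Φ Φb)) (sym (residue-Φ Φa)) c_b≤cₐ ,
      subst (_≤ quotient a) (quotient-+k (Φ-positive Φb)) (quotient-mono-≤ b+k≤a)

    InD⁺ : ∀ {π} → All HasResidue π → Linked (ConsecD k r) π → InD k r π
    InD⁺ residues linked =
      (All.map (Φ-positive ∘ proj₂) residues ,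
       Linked.map (λ (_ , _ , _ , _ , _ , b+k≤a) → ≤-trans (m≤m+n _ k) b+k≤a) linked) ,
      residues , linked

    zipWith-part-residues : ∀ j {c} → All InRange c → All HasResidue (zipWith part j c)
    zipWith-part-residues []      _                      = []
    zipWith-part-residues (_ ∷ _) []                     = []
    zipWith-part-residues (x ∷ j) ((1≤c , c≤r) ∷ ranges) =
      (_ , 1≤c , c≤r , x , refl) ∷ zipWith-part-residues j ranges

    zipWith-part-linked : ∀ {j c} → StrictlyIncreasing j → WeaklyIncreasing c → All InRange c →
                          Linked (flip (ConsecD k r)) (zipWith part j c)
    zipWith-part-linked {[]}                        _ _ _ = []
    zipWith-part-linked {_ ∷ _}      {[]}           _ _ _ = []
    zipWith-part-linked {_ ∷ []}     {_ ∷ _}        _ _ _ = [-]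
    zipWith-part-linked {_ ∷ _ ∷ _}  {_ ∷ []}       _ _ _ = [-]
    zipWith-part-linked {_ ∷ _ ∷ _}  {_ ∷ _ ∷ _}
      (j₀<j₁ ∷ inc) (c₀≤c₁ ∷ winc) (range₀ ∷ range₁ ∷ ranges) =
      ConsecD-part range₀ range₁ c₀≤c₁ j₀<j₁ ∷ zipWith-part-linked inc winc (range₁ ∷ ranges)

    sum-zipWith-part : ∀ j c → length j ≡ length c → sum (zipWith part j c) ≡ k * sum j + sum c
    sum-zipWith-part []      []      _   = sym (cong (_+ 0) (*-zeroʳ k))
    sum-zipWith-part (x ∷ j) (y ∷ c) len =
      trans (cong (λ t → part x y + t) (sum-zipWith-part j c (suc-injective len)))
            (regroup x y k (sum j) (sum c))
      where
      regroup : ∀ x y k a b → y + x * k + (k * a + b) ≡ k * (x + a) + (y + b)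
      regroup = ℕ-Solver.solve-∀

    unzipWith-part : ∀ {j c} → length j ≡ length c → All InRange c →
                     (map quotient (zipWith part j c) , map residue (zipWith part j c)) ≡ (j , c)
    unzipWith-part {[]}    {[]}    _   []                       = refl
    unzipWith-part {x ∷ j} {y ∷ c} len ((1≤y , y≤r) ∷ ranges) =
      cong₂ _,_ (cong₂ _∷_ (quotient-part x 1≤y y≤k) (cong proj₁ unzipped))
                (cong₂ _∷_ (residue-part x 1≤y y≤k) (cong proj₂ unzipped))
      where
      y≤k = ≤-trans y≤r r≤k
      unzipped = unzipWith-part (suc-injective len) ranges

    zipWith-part-quotient-residue : ∀ {ρ} → All (1 ≤_) ρ →
                                    zipWith part (map quotient ρ) (map residue ρ) ≡ ρ
    zipWith-part-quotient-residue []          = refl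
    zipWith-part-quotient-residue (1≤p ∷ pos) =
      cong₂ _∷_ (part-quotient-residue 1≤p) (zipWith-part-quotient-residue pos)

    quotient-residue-linked : ∀ {ρ} → Linked (flip (ConsecD k r)) ρ →
                              StrictlyIncreasing (map quotient ρ) × WeaklyIncreasing (map residue ρ)
    quotient-residue-linked linked =
      Linked-map⁺ (Linked.map (proj₂ ∘ ConsecD-residue-quotient) linked) ,
      Linked-map⁺ (Linked.map (proj₁ ∘ ConsecD-residue-quotient) linked)

    residues-inRange : ∀ {ρ} → All HasResidue ρ → All InRange (map residue ρ)
    residues-inRange residues = All.map⁺ (All.map inRange residues)
      where
      inRange : ∀ {p} → HasResidue p → InRange (residue p)
      inRange (_ , Φp@(1≤c , c≤r , _)) = subst InRange (sym (residue-Φ Φp)) (1≤c , c≤r)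

    ResidueSeq : ℕ → List ℕ → Set
    ResidueSeq m c = WeaklyIncreasing c × All InRange c × length c ≡ m

    residueSeqs : ℕ → Enumeration (List ℕ)
    residueSeqs m = map (map suc) ∘ raise m (boxes m s)

    residueSeqs-isEnumeration : ∀ m → IsEnumeration (residueSeqs m) (ResidueSeq m) sum
    residueSeqs-isEnumeration m =
      map-isEnumeration (map suc) (raise-isEnumeration m (boxes-isEnumeration m s)) forward backward
        (λ _ _ → List.map-injective suc-injective)
      where
      forward : ∀ {v} → Box m s v → ResidueSeq m (map suc v) × sum (map suc v) ≡ m + sum v
      forward {v} box@(_ , _ , len) =
        let winc , bounded , len′ = Box-map-suc box
            positive = All.map⁺ (All.universal (λ _ → s≤s z≤n) v)
        in (winc , All.zip (positive , bounded) , len′) , sum-map-suc v len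
      backward : ∀ {c} → ResidueSeq m c → ∃ λ v → Box m s v × map suc v ≡ c
      backward (winc , ranges , len) =
        let positive , bounded = All.unzip ranges
        in _ , Box-map-pred (winc , bounded , len) , map-suc-pred positive

    count-residueSeqs : ∀ m → count (residueSeqs m) ≗ qpow m ⊛ gauss 1 (m + s) s
    count-residueSeqs m =
      ≗-trans (count-map (map suc) (raise m (boxes m s)))
      (≗-trans (count-raise m (boxes m s)) (⊛-congʳ (qpow m) (count-boxes m s)))

    assemble : List ℕ × List ℕ → List ℕ
    assemble (j , c) = reverse (zipWith part j c)

    decompose : List ℕ → List ℕ × List ℕ
    decompose π = map quotient (reverse π) , map residue (reverse π)

    Decomposed : ℕ → List ℕ × List ℕ → Set
    Decomposed m = StrictSeq m ⟨×⟩ ResidueSeq m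

    assemble-inD : ∀ {m z} → Decomposed m z → InD k r (assemble z) × length (assemble z) ≡ m
    assemble-inD {m} {j , c} ((inc , lenʲ) , winc , ranges , lenᶜ) =
      InD⁺ (All-reverse⁺ (zipWith-part-residues j ranges))
           (Linked-reverse⁺ (zipWith-part-linked inc winc ranges)) ,
      trans (List.length-reverse (zipWith part j c))
            (trans (List.length-zipWith part j c) (trans (cong₂ _⊓_ lenʲ lenᶜ) (⊓-idem m)))

    sum-assemble : ∀ {m z} → Decomposed m z → sum (assemble z) ≡ k * sum (proj₁ z) + sum (proj₂ z)
    sum-assemble {z = j , c} ((_ , lenʲ) , _ , _ , lenᶜ) =
      trans (sum-reverse (zipWith part j c)) (sum-zipWith-part j c (trans lenʲ (sym lenᶜ)))

    decompose-decomposed : ∀ {m π} → InD k r π × length π ≡ m → Decomposed m (decompose π)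
    decompose-decomposed {m} {π} ((_ , residues , linked) , len) =
      (proj₁ increasing , length-decomposed quotient) ,
      proj₂ increasing , residues-inRange (All-reverse⁺ residues) , length-decomposed residue
      where
      increasing = quotient-residue-linked (Linked-reverse⁺ linked)
      length-decomposed : ∀ f → length (map f (reverse π)) ≡ m
      length-decomposed f = trans (List.length-map f (reverse π)) (trans (List.length-reverse π) len)

    assemble-decompose : ∀ {π} → InD k r π → assemble (decompose π) ≡ π
    assemble-decompose {π} ((positive , _) , _) =
      trans (cong reverse (zipWith-part-quotient-residue (All-reverse⁺ positive)))
            (List.reverse-involutive π)

    decompose-assemble : ∀ {m z} → Decomposed m z → decompose (assemble z) ≡ z
    decompose-assemble {z = j , c} ((_ , lenʲ) , _ , ranges , lenᶜ) =
      trans (cong (λ ρ → map quotient ρ , map residue ρ) (List.reverse-involutive (zipWith part j c)))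
            (unzipWith-part (trans lenʲ (sym lenᶜ)) ranges)

    dPartitions : ℕ → Enumeration (List ℕ)
    dPartitions m = map assemble ∘ (strictSeqs m ⋆ residueSeqs m)

    dPartitions-isEnumeration : ∀ m →
      IsEnumeration (dPartitions m) (λ π → InD k r π × length π ≡ m) sum
    dPartitions-isEnumeration m =
      map-isEnumeration assemble
        (⋆-isEnumeration (strictSeqs-isEnumeration m) (residueSeqs-isEnumeration m))
        (λ d → assemble-inD d , sum-assemble d)
        (λ {π} d → decompose π , decompose-decomposed d , assemble-decompose (proj₁ d))
        (λ d d′ eq →
          trans (sym (decompose-assemble d)) (trans (cong decompose eq) (decompose-assemble d′)))

    count-dPartitions : ∀ m → count (dPartitions m) ≗ rhsCoeff k r m
    count-dPartitions m = begin
      count (dPartitions m)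
        ≈⟨ count-map assemble (strictSeqs m ⋆ residueSeqs m) ⟩
      count (strictSeqs m ⋆ residueSeqs m)
        ≈⟨ count-⋆ (strictSeqs m) (residueSeqs m) ⟩
      count (strictSeqs m) ⊛ count (residueSeqs m)
        ≈⟨ ⊛-cong (count-strictSeqs m) (count-residueSeqs m) ⟩
      (qpow (k * (m C 2)) ⊛ pochInv k m) ⊛ (qpow m ⊛ gauss 1 (m + s) s)
        ≈⟨ interchange (qpow (k * (m C 2))) (pochInv k m) (qpow m) (gauss 1 (m + s) s) ⟩
      (qpow (k * (m C 2)) ⊛ qpow m) ⊛ (pochInv k m ⊛ gauss 1 (m + s) s)
        ≈⟨ ≗-sym (⊛-assoc (qpow (k * (m C 2)) ⊛ qpow m) (pochInv k m) (gauss 1 (m + s) s)) ⟩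
      ((qpow (k * (m C 2)) ⊛ qpow m) ⊛ pochInv k m) ⊛ gauss 1 (m + s) s
        ≈⟨ ⊛-congˡ (gauss 1 (m + s) s) (⊛-congˡ (pochInv k m) (qpow-+ (k * (m C 2)) m)) ⟩
      (qpow (k * (m C 2) + m) ⊛ pochInv k m) ⊛ gauss 1 (m + s) s
        ≈⟨ ⊛-congʳ (qpow (k * (m C 2) + m) ⊛ pochInv k m) (λ i → cong (λ a → gauss 1 a s i) index) ⟩
      rhsCoeff k r m ∎
      where
      open ≗-Reasoning
      index : m + s ≡ m + r ∸ 1
      index = sym (cong (_∸ 1) (+-suc m s))

mainTheorem2 : (k r : ℕ) → 1 ≤ r → r ≤ k → (m n : ℕ) →
    Σ (List (List ℕ)) λ L →
      Unique L
      × ((π : List ℕ) → (π ∈ L) ⇔ (InD k r π × length π ≡ m × sum π ≡ n))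
      × (+ (length L) ≡ rhsCoeff k r m n)
mainTheorem2 (suc k′) (suc s) _ r≤k m n =
  dPartitions k′ s r≤k m n ,
  unique enumeration n ,
  (λ π → mk⇔ (assocʳ′ ∘ sound enumeration)
              (λ (inD , len , total) → complete′ enumeration (inD , len) total)) ,
  count-dPartitions k′ s r≤k m n
  where
  enumeration = dPartitions-isEnumeration k′ s r≤k m
mainTheorem2 _        zero    () _
mainTheorem2 zero     (suc s) _  ()
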